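{- Let $(N,+,-)$ be a DFBQ with an element $e$ which is a right identity for $+$, satisfies $a-a=e$ for all $a$, and satisfies $a-e=a$ for all $a\in N$. Then there is a group operation $*$ on $N$ such that $(N,+)$ and $(N,-)$ are both isotopic to the group $(N,*)$.
   Context: A DFBQ $(N,+,-)$ is a set $N$ with two binary operations $+$ and $-$ such that $(N,+)$ and $(N,-)$ are both quasigroups (for all $a,b$, the equations $a\circ x=b$ and $y\circ a=b$ have unique solutions) and $a-b=(a+c)-(b+c)$ for all $a,b,c\in N$. Two binary structures $(S,\circ)$ and $(T,\star)$ are isotopic if there are bijections $\alpha,\beta,\gamma:S\to T$ with $\alpha(a\circ b)=\beta(a)\star\gamma(b)$ for all $a,b\in S$. -}

module Defs where

open import Level using (Level)
open import Data.Product using (Σ; _×_; _,_; ∃!)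
open import Relation.Binary.PropositionalEquality using (_≡_)
open import Function.Base using (_∘_)
open import Function.Bundles using (_⤖_; Bijection)
open import Algebra.Core using (Op₂)

private variable ℓ : Level

IsQuasigroupOp : {S : Set ℓ} → Op₂ S → Set ℓ
IsQuasigroupOp {S = S} _∘_ =
  (∀ a b → ∃! _≡_ (λ x → a ∘ x ≡ b)) × (∀ a b → ∃! _≡_ (λ y → y ∘ a ≡ b))

record IsDFBQ {N : Set ℓ} (_⊕_ _⊖_ : Op₂ N) : Set ℓ where
  field
    quasigroup-+ : IsQuasigroupOp _⊕_
    quasigroup-- : IsQuasigroupOp _⊖_
    compat : ∀ a b c → a ⊖ b ≡ (a ⊕ c) ⊖ (b ⊕ c)

Isotopic : {S T : Set ℓ} → Op₂ S → Op₂ T → Set ℓ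
Isotopic {S = S} {T = T} _∘_ _⋆_ =
  Σ (S ⤖ T) λ α → Σ (S ⤖ T) λ β → Σ (S ⤖ T) λ γ →
    ∀ a b → Bijection.to α (a ∘ b) ≡ Bijection.to β a ⋆ Bijection.to γ b

-- Since every d is some e ⊕ c and every x some a ⊕ c, compatibility together with
-- a ⊖ e = a makes ⊖ right invariant: (x ⊖ d) ⊖ (y ⊖ d) = x ⊖ y. With x ⊖ x = e and
-- x ⊖ e = x these are the axioms of the right division x y⁻¹ of a group, whose product
-- is x * y = x ⊖ (e ⊖ y) and whose inverse is y ↦ e ⊖ y. Then a ⊖ b = a * (e ⊖ b) and
-- a ⊕ c = a * (e ⊕ c), where y ↦ e ⊖ y is an involution and c ↦ e ⊕ c is bijective.
module Submission where

open import Defs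
open import Level using (Level)
open import Data.Product using (Σ; _×_; _,_; proj₁; proj₂)
open import Relation.Binary.PropositionalEquality
  using (_≡_; refl; sym; trans; cong; cong₂; isEquivalence; module ≡-Reasoning)
open import Algebra.Core using (Op₂)
open import Algebra.Structures using (IsGroup)
open import Function.Bundles using (_⤖_; mk↔ₛ′; Bijection)
open import Function.Properties.Inverse using (↔⇒⤖)
open import Function.Construct.Identity using (⤖-id)

private variable ℓ : Level

involution⤖ : {S : Set ℓ} (f : S → S) → (∀ x → f (f x) ≡ x) → S ⤖ S
involution⤖ f f∘f≡id = ↔⇒⤖ (mk↔ₛ′ f f f∘f≡id f∘f≡id)

leftTranslation⤖ : {S : Set ℓ} {_∘_ : Op₂ S} → IsQuasigroupOp _∘_ → S → S ⤖ S
leftTranslation⤖ {S = S} {_∘_ = _∘_} (leftDivisible , _) a =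
  ↔⇒⤖ (mk↔ₛ′ (a ∘_) solve (λ y → proj₁ (proj₂ (leftDivisible a y)))
              (λ x → proj₂ (proj₂ (leftDivisible a (a ∘ x))) refl))
  where
  solve : S → S
  solve y = proj₁ (leftDivisible a y)

isotopic-byRightBijection : {S : Set ℓ} (_∘_ _⋆_ : Op₂ S) (γ : S ⤖ S) →
  (∀ a b → a ∘ b ≡ a ⋆ Bijection.to γ b) → Isotopic _∘_ _⋆_
isotopic-byRightBijection {S = S} _ _ γ ∘≡⋆γ = ⤖-id S , ⤖-id S , γ , ∘≡⋆γ

module RightInvariantDivision {N : Set ℓ} (_⊖_ : Op₂ N) (e : N)
    (⊖-self : ∀ x → x ⊖ x ≡ e) (⊖-identityʳ : ∀ x → x ⊖ e ≡ x)
    (⊖-invariantʳ : ∀ x y d → (x ⊖ d) ⊖ (y ⊖ d) ≡ x ⊖ y) where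
  open ≡-Reasoning

  inv : N → N
  inv y = e ⊖ y

  _*_ : Op₂ N
  x * y = x ⊖ inv y

  inv-involutive : ∀ y → inv (inv y) ≡ y
  inv-involutive y = begin
    e ⊖ (e ⊖ y)       ≡⟨ cong (_⊖ (e ⊖ y)) (sym (⊖-self y)) ⟩
    (y ⊖ y) ⊖ (e ⊖ y) ≡⟨ ⊖-invariantʳ y e y ⟩
    y ⊖ e             ≡⟨ ⊖-identityʳ y ⟩
    y                 ∎

  inv-⊖ : ∀ x y → inv (x ⊖ y) ≡ y ⊖ x
  inv-⊖ x y = trans (cong (_⊖ (x ⊖ y)) (sym (⊖-self y))) (⊖-invariantʳ y x y)

  ⊖≡*inv : ∀ x y → x ⊖ y ≡ x * inv y
  ⊖≡*inv x y = cong (x ⊖_) (sym (inv-involutive y))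

  *-⊖-cancelʳ : ∀ x y → (x * y) ⊖ y ≡ x
  *-⊖-cancelʳ x y = begin
    (x ⊖ inv y) ⊖ y           ≡⟨ ⊖≡*inv (x ⊖ inv y) y ⟩
    (x ⊖ inv y) ⊖ (e ⊖ inv y) ≡⟨ ⊖-invariantʳ x e (inv y) ⟩
    x ⊖ e                     ≡⟨ ⊖-identityʳ x ⟩
    x                         ∎

  *-assoc : ∀ x y z → (x * y) * z ≡ x * (y * z)
  *-assoc x y z = begin
    (x ⊖ inv y) ⊖ inv z                       ≡⟨ cong ((x ⊖ inv y) ⊖_) (sym (*-⊖-cancelʳ (inv z) (inv y))) ⟩
    (x ⊖ inv y) ⊖ ((inv z * inv y) ⊖ inv y)   ≡⟨ ⊖-invariantʳ x (inv z * inv y) (inv y) ⟩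
    x ⊖ (inv z ⊖ inv (inv y))                 ≡⟨ cong (λ w → x ⊖ (inv z ⊖ w)) (inv-involutive y) ⟩
    x ⊖ (inv z ⊖ y)                           ≡⟨ cong (x ⊖_) (sym (inv-⊖ y (inv z))) ⟩
    x ⊖ inv (y ⊖ inv z)                       ∎

  isGroup : IsGroup _≡_ _*_ e inv
  isGroup = record
    { isMonoid = record
      { isSemigroup = record
        { isMagma = record { isEquivalence = isEquivalence ; ∙-cong = cong₂ _*_ }
        ; assoc = *-assoc
        }
      ; identity = inv-involutive , λ x → trans (cong (x ⊖_) (⊖-self e)) (⊖-identityʳ x)
      }
    ; inverse = (λ x → ⊖-self (inv x)) , (λ x → trans (sym (⊖≡*inv x x)) (⊖-self x))
    ; ⁻¹-cong = cong inv
    }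

  ⊖-isotopic-* : Isotopic _⊖_ _*_
  ⊖-isotopic-* = isotopic-byRightBijection _⊖_ _*_ (involution⤖ inv inv-involutive) ⊖≡*inv

module DFBQ {N : Set ℓ} {_⊕_ _⊖_ : Op₂ N} (dfbq : IsDFBQ _⊕_ _⊖_)
    (e : N) (⊖-identityʳ : ∀ x → x ⊖ e ≡ x) where
  open IsDFBQ dfbq
  open ≡-Reasoning

  ⊕-⊖-cancelʳ : ∀ a c → (a ⊕ c) ⊖ (e ⊕ c) ≡ a
  ⊕-⊖-cancelʳ a c = trans (sym (compat a e c)) (⊖-identityʳ a)

  ⊖-invariantʳ : ∀ x y d → (x ⊖ d) ⊖ (y ⊖ d) ≡ x ⊖ y
  ⊖-invariantʳ x y d
    with proj₁ quasigroup-+ e d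
  ... | c , refl , _
    with proj₂ quasigroup-+ c x | proj₂ quasigroup-+ c y
  ... | a , refl , _ | b , refl , _ =
    trans (cong₂ _⊖_ (⊕-⊖-cancelʳ a c) (⊕-⊖-cancelʳ b c)) (compat a b c)

  module Group (⊖-self : ∀ x → x ⊖ x ≡ e) where
    open RightInvariantDivision _⊖_ e ⊖-self ⊖-identityʳ ⊖-invariantʳ public

    ⊕≡*[e⊕] : ∀ a c → a ⊕ c ≡ a * (e ⊕ c)
    ⊕≡*[e⊕] a c = begin
      a ⊕ c                                 ≡⟨ sym (⊖-identityʳ (a ⊕ c)) ⟩
      (a ⊕ c) ⊖ e                           ≡⟨ sym (⊖-invariantʳ (a ⊕ c) e (e ⊕ c)) ⟩
      ((a ⊕ c) ⊖ (e ⊕ c)) ⊖ inv (e ⊕ c)     ≡⟨ cong (_⊖ inv (e ⊕ c)) (⊕-⊖-cancelʳ a c) ⟩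
      a ⊖ inv (e ⊕ c)                       ∎

    ⊕-isotopic-* : Isotopic _⊕_ _*_
    ⊕-isotopic-* = isotopic-byRightBijection _⊕_ _*_ (leftTranslation⤖ quasigroup-+ e) ⊕≡*[e⊕]

mainTheorem8 : {ℓ : Level} {N : Set ℓ} (_⊕_ _⊖_ : Op₂ N) → IsDFBQ _⊕_ _⊖_ →
    (e : N) → (∀ a → a ⊕ e ≡ a) → (∀ a → a ⊖ a ≡ e) → (∀ a → a ⊖ e ≡ a) →
    Σ (Op₂ N) λ _*_ → Σ N λ ε → Σ (N → N) λ inv →
      IsGroup _≡_ _*_ ε inv × Isotopic _⊕_ _*_ × Isotopic _⊖_ _*_
mainTheorem8 _⊕_ _⊖_ dfbq e _ ⊖-self ⊖-identityʳ =
  _*_ , e , inv , isGroup , ⊕-isotopic-* , ⊖-isotopic-*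
  where open DFBQ.Group dfbq e ⊖-identityʳ ⊖-self
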